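{- Let $t\ge1$ and let $G$ be a group of order $4t+2$. (i) If $\psi\in Z^2(G,\langle-1\rangle)$ is quasi-orthogonal, then $T=\{(1,g):g\in G\}$ is a quasi-Hadamard subset of $E_\psi$ with respect to the central subgroup $Z=\{(1,1),(-1,1)\}$. (ii) Let $E$ be a group with a central subgroup $\langle -1\rangle$ of order $2$ such that $E/\langle-1\rangle\cong G$ (identify $G=E/\langle -1\rangle$). If $T$ is a quasi-Hadamard subset of $E$ with respect to $\langle-1\rangle$ and $1\in T$, then $\psi_T$ is quasi-orthogonal.
   Context: A (normalized) cocycle is a map $\psi:G\times G\to\{\pm1\}$ with $\psi(g,h)\psi(gh,k)=\psi(g,hk)\psi(h,k)$ for all $g,h,k$ and $\psi(1,1)=1$; $Z^2(G,\langle-1\rangle)$ is the set of these. For an ordering $g_1=1,\dots,g_{4t+2}$ of $G$, $M_\psi=[\psi(g_i,g_j)]_{i,j}$; for an $n\times n$ $(\pm1)$-matrix $M$ with first row all $1$s, $RE(M)=\sum_{i=2}^n|\sum_j m_{i,j}|$; $\psi$ is quasi-orthogonal if $RE(M_\psi)=4t$. $E_\psi$ is the group with elements $\{(u,g):u\in\{\pm1\},g\in G\}$ and multiplication $(u,g)(v,h)=(uv\,\psi(g,h),gh)$. Given a group $E$ of order $8t+4\ge 12$ with a central subgroup $Z$ of order $2$, a quasi-Hadamard subset of $E$ (with respect to $Z$) is a transversal $T$ for the cosets of $Z$ in $E$ containing a subset $S\subset T\setminus Z$ with $|S|=2t+1$ such that $|T\cap xT|=2t+1$ for all $x\in S$ and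 $|T\cap xT|\in\{2t,2t+2\}$ for all $x\in T\setminus(S\cup Z)$. For a transversal $T$ of $\langle-1\rangle$ in $E$ with $1\in T$, let $\sigma:G\to T$ send each coset to its representative in $T$, and define $\psi_T(g,h)=\sigma(g)\sigma(h)\sigma(gh)^{ -1}\in\langle-1\rangle$; this is a cocycle in $Z^2(G,\langle-1\rangle)$. -}

module Defs where

open import Data.Bool using (Bool; true; false; _∧_; _∨_; not; _xor_; if_then_else_)
open import Data.Nat using (ℕ; _+_; _*_)
open import Data.Integer as ℤ using (ℤ; ∣_∣; _◃_)
open import Data.Fin as Fin using (Fin)
open import Data.List using (List; foldr; length; filterᵇ; map; cartesianProduct; allFin)
open import Data.Sign using (Sign) renaming (_*_ to _*ₛ_)
import Data.Sign as S
open import Data.Product using (_×_; _,_; Σ)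
open import Data.Sum using (_⊎_)
open import Data.Nat.ListAction using (sum)
open import Data.Bool.ListAction using (any)
open import Function using (_∘_)
open import Relation.Nullary using (¬_; does)
open import Relation.Binary.Definitions using (DecidableEquality)
open import Relation.Binary.PropositionalEquality using (_≡_; _≢_)
import Data.Product.Properties as PP
import Data.Sign.Properties as SP

module _ {n : ℕ} (_∙_ : Fin n → Fin n → Fin n) (ε : Fin n) where

  IsCocycle : (Fin n → Fin n → Sign) → Set
  IsCocycle ψ =
    (∀ g h k → ψ g h *ₛ ψ (g ∙ h) k ≡ ψ g (h ∙ k) *ₛ ψ h k) × ψ ε ε ≡ S.+

  entry : (Fin n → Fin n → Sign) → Fin n → Fin n → ℤ
  entry ψ g h = ψ g h ◃ 1

  rowSum : (Fin n → Fin n → Sign) → Fin n → ℤ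
  rowSum ψ g = foldr ℤ._+_ (ℤ.+ 0) (map (entry ψ g) (allFin n))

  -- RE(M_ψ) = Σ_{i ≥ 2} |Σ_j ψ(g_i,g_j)|, for an ordering with g_1 = 1:
  -- the rows i ≥ 2 are exactly the rows indexed by g ≠ 1.
  RE : (Fin n → Fin n → Sign) → ℕ
  RE ψ = sum (map (λ g → ∣ rowSum ψ g ∣)
                  (filterᵇ (λ g → not (does (g Fin.≟ ε))) (allFin n)))

  QuasiOrthogonal : ℕ → (Fin n → Fin n → Sign) → Set
  QuasiOrthogonal t ψ = RE ψ ≡ 4 * t

-- Quasi-Hadamard subsets of a finite group E (given by a complete,
-- duplicate-free enumeration `elems`) w.r.t. a central subgroup Z = {e, z}.
-- Subsets of E are Boolean predicates.

module _ {A : Set} (_≟_ : DecidableEquality A) (elems : List A)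
         (_·_ : A → A → A) (e z : A) where

  count : (A → Bool) → ℕ
  count P = length (filterᵇ P elems)

  inZ : A → Bool
  inZ x = does (x ≟ e) ∨ does (x ≟ z)

  IsTransversal : (A → Bool) → Set
  IsTransversal T = ∀ x → (T x xor T (x · z)) ≡ true

  inTranslate : (A → Bool) → A → A → Bool
  inTranslate T x y = any (λ s → T s ∧ does (y ≟ (x · s))) elems

  interSize : (A → Bool) → A → ℕ
  interSize T x = count (λ y → T y ∧ inTranslate T x y)

  IsQuasiHadamard : ℕ → (A → Bool) → Set
  IsQuasiHadamard t T =
    IsTransversal T ×
    Σ (A → Bool) λ S →
      (∀ x → S x ≡ true → (T x ≡ true × inZ x ≡ false)) ×
      (count S ≡ 2 * t + 1) ×
      (∀ x → S x ≡ true → interSize T x ≡ 2 * t + 1) ×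
      (∀ x → T x ≡ true → S x ≡ false → inZ x ≡ false →
         interSize T x ≡ 2 * t ⊎ interSize T x ≡ 2 * t + 2)

module _ {n : ℕ} (_∙_ : Fin n → Fin n → Fin n) (ψ : Fin n → Fin n → Sign) where

  Eψ-mul : Sign × Fin n → Sign × Fin n → Sign × Fin n
  Eψ-mul (u , g) (v , h) = ((u *ₛ v) *ₛ ψ g h , g ∙ h)

Eψ-elems : (n : ℕ) → List (Sign × Fin n)
Eψ-elems n = cartesianProduct (S.+ Data.List.∷ S.- Data.List.∷ Data.List.[]) (allFin n)
  where import Data.List

Eψ-≟ : {n : ℕ} → DecidableEquality (Sign × Fin n)
Eψ-≟ = PP.≡-dec SP._≟_ Fin._≟_

isPlus : Sign → Bool
isPlus S.+ = true
isPlus S.- = false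

-- ψ_T(g,h) = σ(g)σ(h)σ(gh)⁻¹ ∈ ⟨-1⟩ = {1, m}, encoded as + / -

module _ {n m : ℕ} (_∙_ : Fin n → Fin n → Fin n)
         (_·_ : Fin m → Fin m → Fin m) (eE : Fin m) (_⁻¹ : Fin m → Fin m)
         (σ : Fin n → Fin m) where

  ψ-of : Fin n → Fin n → Sign
  ψ-of g h = if does (((σ g · σ h) · (σ (g ∙ h) ⁻¹)) Fin.≟ eE) then S.+ else S.-

module Submission where

-- Everything is reduced to counting.  Write P g for the number of +1 entries in
-- row g of M_ψ and c = 2t + 1, so |G| = 2c.  Then |row sum| = 2 |P g - c|, and
-- ψ is quasi-orthogonal iff the deviations |P g - c| of the nonidentity rows
-- add up to 2t.  On the other side, |T ∩ xT| is exactly P g for the element x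
-- of T over g, both for T = {(1,g)} in E_ψ and for ψ = ψ_T.
--
-- (i) For a cocycle, the parity of the number of -1 entries of row g is a
--     homomorphism G → Z/2.  Even rows cannot be balanced (c is odd), so the
--     2t total deviation forces this character to be nontrivial, the even
--     nonidentity rows to have deviation exactly 1 and the c odd rows to be
--     balanced; the odd rows form the set S.
-- (ii) The quasi-Hadamard conditions say deviation 0 on the c rows of S and
--     deviation 1 on the other 2t nonidentity rows: total 2t.

open import Defs
open import Data.Bool using (Bool; true)
open import Data.Nat using (ℕ; _+_; _*_; _≤_)
open import Data.Fin as Fin using (Fin)
open import Data.List using (allFin)
open import Data.Sign using (Sign)
import Data.Sign as S
open import Data.Product using (_×_; _,_; proj₁; ∃)
open import Data.Sum using (_⊎_)
open import Algebra.Structures using (IsGroup)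
open import Relation.Binary.PropositionalEquality using (_≡_; _≢_)

open import Algebra.Bundles using (Group)
import Algebra.Properties.Group as GroupProperties
open import Data.Bool using (false; not; _∧_; _xor_; if_then_else_)
import Data.Bool as Bool
open import Data.Bool.Properties using (not-involutive; T-≡; ∧-conicalˡ; ∧-conicalʳ)
open import Data.Bool.ListAction using (any)
open import Data.Empty using (⊥-elim)
open import Data.Fin.Properties using (any?)
open import Data.Integer as ℤ using (_◃_; _⊖_)
import Data.Integer.Properties as ℤP
open import Data.List using (List; []; _++_; length; filterᵇ; map; tabulate; foldr)
import Data.List.Properties as List
open import Data.List.Membership.Propositional using (_∈_; lose)
open import Data.List.Membership.Propositional.Properties using (∈-map⁺; ∈-++⁺ˡ; ∈-allFin)
open import Data.List.Relation.Unary.Any using (satisfied)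
open import Data.List.Relation.Unary.Any.Properties using (any⁺; any⁻)
open import Data.Nat using (zero; suc; _∸_; z≤n; ∣_-_∣; parity)
open import Data.Parity using (Parity; 0ℙ; 1ℙ)
import Data.Parity as ℙ
import Data.Parity.Properties as ℙP
import Data.Nat.ListAction as ℕList
open import Data.Nat.Properties
open import Data.Nat.Tactic.RingSolver using (solve-∀)
open import Algebra.Properties.Semiring.Sum +-*-semiring
  using (sum-syntax; sum-cong-≗; ∑-distrib-+; ∑-comm; *-distribˡ-sum)
  renaming (sum to ∑)
open import Data.Product using (proj₂)
open import Data.Sum using (inj₁; inj₂)
import Data.Sign.Properties as SP
open import Function using (_∘_; id; Equivalence; mk⇔)
open import Relation.Binary.PropositionalEquality using (refl; sym; trans; cong; cong₂; subst; module ≡-Reasoning)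
open import Relation.Nullary using (does; Dec; yes; no)
open import Relation.Nullary.Decidable using (dec-true; dec-false; does-⇔; T?)

𝟙 : Bool → ℕ
𝟙 true  = 1
𝟙 false = 0

𝟙-not : ∀ b → 𝟙 b + 𝟙 (not b) ≡ 1
𝟙-not true  = refl
𝟙-not false = refl

bool-ext : ∀ {b c : Bool} → (b ≡ true → c ≡ true) → (c ≡ true → b ≡ true) → b ≡ c
bool-ext {true}  {true}  f g = refl
bool-ext {true}  {false} f g = sym (f refl)
bool-ext {false} {true}  f g = g refl
bool-ext {false} {false} f g = refl

does-true : ∀ {a} {A : Set a} (d : Dec A) → does d ≡ true → A
does-true (yes p) _ = p

true≢false : true ≢ false
true≢false ()

∑-const : ∀ n c → ∑[ i < n ] c ≡ n * c
∑-const zero    c = refl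
∑-const (suc n) c = cong (c +_) (∑-const n c)

∑-zero : ∀ n → ∑[ i < n ] 0 ≡ 0
∑-zero n = trans (∑-const n 0) (*-zeroʳ n)

∑-𝟙-complement : ∀ n (χ : Fin n → Bool) → ∑[ i < n ] 𝟙 (χ i) + ∑[ i < n ] 𝟙 (not (χ i)) ≡ n
∑-𝟙-complement n χ = begin
  ∑[ i < n ] 𝟙 (χ i) + ∑[ i < n ] 𝟙 (not (χ i)) ≡⟨ sym (∑-distrib-+ (𝟙 ∘ χ) (𝟙 ∘ not ∘ χ)) ⟩
  ∑[ i < n ] (𝟙 (χ i) + 𝟙 (not (χ i)))          ≡⟨ sum-cong-≗ (λ i → 𝟙-not (χ i)) ⟩
  ∑[ i < n ] 1                                  ≡⟨ ∑-const n 1 ⟩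
  n * 1                                         ≡⟨ *-identityʳ n ⟩
  n                                             ∎
  where open ≡-Reasoning

∑-δ : ∀ n (a : Fin n) (f : Fin n → ℕ) →
      ∑[ i < n ] (if does (i Fin.≟ a) then f i else 0) ≡ f a
∑-δ (suc n) Fin.zero    f = trans (cong (f Fin.zero +_) (∑-zero n)) (+-identityʳ _)
∑-δ (suc n) (Fin.suc a) f = ∑-δ n a (f ∘ Fin.suc)

∑-mono-≤ : ∀ n {f g : Fin n → ℕ} → (∀ i → f i ≤ g i) → ∑ f ≤ ∑ g
∑-mono-≤ zero    le = z≤n
∑-mono-≤ (suc n) le = +-mono-≤ (le Fin.zero) (∑-mono-≤ n (le ∘ Fin.suc))

+-tight : ∀ {a b c d} → a ≤ b → c ≤ d → a + c ≡ b + d → a ≡ b × c ≡ d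
+-tight {a} {b} {c} {d} a≤b c≤d a+c≡b+d = a≡b , +-cancelˡ-≡ a c d (trans a+c≡b+d (cong (_+ d) (sym a≡b)))
  where
  b+c≤a+c : b + c ≤ a + c
  b+c≤a+c = subst (b + c ≤_) (sym a+c≡b+d) (+-monoʳ-≤ b c≤d)
  a≡b : a ≡ b
  a≡b = ≤-antisym a≤b (+-cancelʳ-≤ c b a b+c≤a+c)

∑-tight : ∀ n {f g : Fin n → ℕ} → (∀ i → f i ≤ g i) → ∑ f ≡ ∑ g → ∀ i → f i ≡ g i
∑-tight (suc n) le eq Fin.zero    = proj₁ (+-tight (le Fin.zero) (∑-mono-≤ n (le ∘ Fin.suc)) eq)
∑-tight (suc n) le eq (Fin.suc i) =
  ∑-tight n (le ∘ Fin.suc) (proj₂ (+-tight (le Fin.zero) (∑-mono-≤ n (le ∘ Fin.suc)) eq)) i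

∑-section : ∀ N n (T : Fin N → Bool) (σ : Fin n → Fin N) (π : Fin N → Fin n) →
            (∀ y → T y ≡ true → y ≡ σ (π y)) → (∀ h → π (σ h) ≡ h) →
            (F : Fin N → ℕ) → (∀ y → T y ≡ false → F y ≡ 0) →
            ∑ F ≡ ∑[ h < n ] F (σ h)
∑-section N n T σ π onT πσ F offT = sym (begin
  ∑[ h < n ] F (σ h)                            ≡⟨ sum-cong-≗ (λ h → sym (∑-δ N (σ h) F)) ⟩
  ∑[ h < n ] ∑[ y < N ] δ y h                    ≡⟨ ∑-comm (λ h y → δ y h) ⟩
  ∑[ y < N ] ∑[ h < n ] δ y h                    ≡⟨ sum-cong-≗ fibre ⟩
  ∑ F                                           ∎)
  where
  open ≡-Reasoning
  δ : Fin N → Fin n → ℕ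
  δ y h = if does (y Fin.≟ σ h) then F y else 0
  -- the fibre of y contains exactly one h (namely π y) when y ∈ T, and F y = 0 otherwise
  fibre : ∀ y → ∑[ h < n ] δ y h ≡ F y
  fibre y with T y in Ty
  ... | true  = trans (sum-cong-≗ (λ h → cong (λ b → if b then F y else 0)
                        (does-⇔ (mk⇔ (λ y≡σh → trans (sym (πσ h)) (cong π (sym y≡σh)))
                                     (λ h≡πy → trans (onT y Ty) (cong σ (sym h≡πy))))
                                (y Fin.≟ σ h) (h Fin.≟ π y))))
                      (∑-δ n (π y) (λ _ → F y))
  ... | false = trans (sum-cong-≗ (λ h → vanish (does (y Fin.≟ σ h))))
                      (trans (∑-zero n) (sym (offT y Ty)))
    where
    vanish : ∀ b → (if b then F y else 0) ≡ 0
    vanish true  = offT y Ty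
    vanish false = refl

∑-bijection : ∀ n (p q : Fin n → Fin n) → (∀ i → p (q i) ≡ i) → (∀ i → q (p i) ≡ i) →
              (F : Fin n → ℕ) → ∑[ i < n ] F (p i) ≡ ∑ F
∑-bijection n p q pq qp F = sym (∑-section n n (λ _ → true) p q (λ y _ → sym (pq y)) qp F (λ y ()))

count-tabulate : ∀ {A : Set} n (P : A → Bool) (g : Fin n → A) →
                 length (filterᵇ P (tabulate g)) ≡ ∑[ i < n ] 𝟙 (P (g i))
count-tabulate zero    P g = refl
count-tabulate (suc n) P g with P (g Fin.zero)
... | true  = cong suc (count-tabulate n P (g ∘ Fin.suc))
... | false = count-tabulate n P (g ∘ Fin.suc)

count-++ : ∀ {A : Set} (P : A → Bool) (xs ys : List A) →
           length (filterᵇ P (xs ++ ys)) ≡ length (filterᵇ P xs) + length (filterᵇ P ys)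
count-++ P xs ys = trans (cong length (List.filter-++ (T? ∘ P) xs ys)) (List.length-++ (filterᵇ P xs))

sum-filter-tabulate : ∀ {A : Set} n (P : A → Bool) (f : A → ℕ) (g : Fin n → A) →
  ℕList.sum (map f (filterᵇ P (tabulate g))) ≡ ∑[ i < n ] (if P (g i) then f (g i) else 0)
sum-filter-tabulate zero    P f g = refl
sum-filter-tabulate (suc n) P f g with P (g Fin.zero)
... | true  = cong (f (g Fin.zero) +_) (sum-filter-tabulate n P f (g ∘ Fin.suc))
... | false = sum-filter-tabulate n P f (g ∘ Fin.suc)

any-intro : ∀ {A : Set} (p : A → Bool) {x : A} {xs : List A} → x ∈ xs → p x ≡ true → any p xs ≡ true
any-intro p x∈xs px = Equivalence.to T-≡ (any⁺ p (lose x∈xs (Equivalence.from T-≡ px)))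

any-elim : ∀ {A : Set} (p : A → Bool) (xs : List A) → any p xs ≡ true → ∃ λ x → p x ≡ true
any-elim p xs anyp with satisfied (any⁻ p xs (Equivalence.from T-≡ anyp))
... | x , px = x , Equivalence.to T-≡ px

isOdd : Parity → Bool
isOdd 0ℙ = false
isOdd 1ℙ = true

odd : ℕ → Bool
odd = isOdd ∘ parity

odd-+ : ∀ a b → odd (a + b) ≡ odd a xor odd b
odd-+ a b = trans (cong isOdd (ℙP.+-homo-+ a b)) (isOdd-+ (parity a) (parity b))
  where
  isOdd-+ : ∀ p q → isOdd (p ℙ.+ q) ≡ isOdd p xor isOdd q
  isOdd-+ 0ℙ q  = refl
  isOdd-+ 1ℙ 0ℙ = refl
  isOdd-+ 1ℙ 1ℙ = refl

odd-* : ∀ a b → odd (a * b) ≡ odd a ∧ odd b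
odd-* a b = trans (cong isOdd (ℙP.*-homo-* a b)) (isOdd-* (parity a) (parity b))
  where
  isOdd-* : ∀ p q → isOdd (p ℙ.* q) ≡ isOdd p ∧ isOdd q
  isOdd-* 0ℙ q = refl
  isOdd-* 1ℙ q = refl

odd-∑-cong : ∀ n {f g : Fin n → ℕ} → (∀ i → odd (f i) ≡ odd (g i)) → odd (∑ f) ≡ odd (∑ g)
odd-∑-cong zero    eq = refl
odd-∑-cong (suc n) {f} {g} eq = begin
  odd (f Fin.zero + ∑ (f ∘ Fin.suc))       ≡⟨ odd-+ (f Fin.zero) _ ⟩
  odd (f Fin.zero) xor odd (∑ (f ∘ Fin.suc)) ≡⟨ cong₂ _xor_ (eq Fin.zero) (odd-∑-cong n (eq ∘ Fin.suc)) ⟩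
  odd (g Fin.zero) xor odd (∑ (g ∘ Fin.suc)) ≡⟨ sym (odd-+ (g Fin.zero) _) ⟩
  odd (g Fin.zero + ∑ (g ∘ Fin.suc))       ∎
  where open ≡-Reasoning

∣⊖∣≡∣-∣ : ∀ m n → ℤ.∣ m ⊖ n ∣ ≡ ∣ m - n ∣
∣⊖∣≡∣-∣ m n with ≤-total m n
... | inj₁ m≤n = trans (ℤP.∣⊖∣-≤ m≤n) (sym (m≤n⇒∣m-n∣≡n∸m m≤n))
... | inj₂ n≤m = begin
  ℤ.∣ m ⊖ n ∣ ≡⟨ ℤP.∣m⊖n∣≡∣n⊖m∣ m n ⟩
  ℤ.∣ n ⊖ m ∣ ≡⟨ ℤP.∣⊖∣-≤ n≤m ⟩
  m ∸ n       ≡⟨ sym (m≤n⇒∣m-n∣≡n∸m n≤m) ⟩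
  ∣ n - m ∣   ≡⟨ ∣-∣-comm n m ⟩
  ∣ m - n ∣   ∎
  where open ≡-Reasoning

∣-∣≡1⇒ : ∀ a b → ∣ a - b ∣ ≡ 1 → suc a ≡ b ⊎ a ≡ suc b
∣-∣≡1⇒ zero    b       e = inj₁ (sym e)
∣-∣≡1⇒ (suc a) zero    e = inj₂ (cong suc (suc-injective e))
∣-∣≡1⇒ (suc a) (suc b) e with ∣-∣≡1⇒ a b e
... | inj₁ 1+a≡b = inj₁ (cong suc 1+a≡b)
... | inj₂ a≡1+b = inj₂ (cong suc a≡1+b)

∣n-1+n∣≡1 : ∀ n → ∣ n - suc n ∣ ≡ 1
∣n-1+n∣≡1 zero    = refl
∣n-1+n∣≡1 (suc n) = ∣n-1+n∣≡1 n

∣1+n-n∣≡1 : ∀ n → ∣ suc n - n ∣ ≡ 1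
∣1+n-n∣≡1 n = trans (∣-∣-comm (suc n) n) (∣n-1+n∣≡1 n)

plus minus : Sign → ℕ
plus  s = 𝟙 (isPlus s)
minus s = 𝟙 (not (isPlus s))

minus-*-parity : ∀ a b → odd (minus a + minus b) ≡ odd (minus (a S.* b))
minus-*-parity S.+ S.+ = refl
minus-*-parity S.+ S.- = refl
minus-*-parity S.- S.+ = refl
minus-*-parity S.- S.- = refl

isPlus⇒+ : ∀ {s} → isPlus s ≡ true → s ≡ S.+
isPlus⇒+ {S.+} _ = refl

isPlus-if : ∀ b → isPlus (if b then S.+ else S.-) ≡ b
isPlus-if true  = refl
isPlus-if false = refl

plusCount minusCount : ∀ {n} → (Fin n → Sign) → ℕ
plusCount  {n} r = ∑[ k < n ] plus (r k)
minusCount {n} r = ∑[ k < n ] minus (r k)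

plusCount+minusCount : ∀ {n} (r : Fin n → Sign) → plusCount r + minusCount r ≡ n
plusCount+minusCount {n} r = ∑-𝟙-complement n (isPlus ∘ r)

signSum : ∀ n (r : Fin n → Sign) →
          foldr ℤ._+_ (ℤ.+ 0) (tabulate (λ k → r k ◃ 1)) ≡ plusCount r ⊖ minusCount r
signSum zero    r = refl
signSum (suc n) r with r Fin.zero
... | S.+ = trans (cong (ℤ._+_ (ℤ.+ 1)) (signSum n (r ∘ Fin.suc)))
                  (ℤP.distribʳ-⊖-+-pos 1 (plusCount (r ∘ Fin.suc)) (minusCount (r ∘ Fin.suc)))
... | S.- = trans (cong (ℤ._+_ ℤ.-[1+ 0 ]) (signSum n (r ∘ Fin.suc)))
                  (ℤP.distribʳ-⊖-+-neg 0 (plusCount (r ∘ Fin.suc)) (minusCount (r ∘ Fin.suc)))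

module Punctured {n : ℕ} (ε : Fin n) where

  isNotε : Fin n → Bool
  isNotε g = not (does (g Fin.≟ ε))

  puncture : (Fin n → ℕ) → Fin n → ℕ
  puncture X g = if isNotε g then X g else 0

  ∑≠ε : (Fin n → ℕ) → ℕ
  ∑≠ε X = ∑[ g < n ] puncture X g

  puncture-≢ : ∀ X {g} → g ≢ ε → puncture X g ≡ X g
  puncture-≢ X {g} g≢ε rewrite dec-false (g Fin.≟ ε) g≢ε = refl

  puncture-lift : (R : ℕ → ℕ → Set) → R 0 0 → ∀ {X Y} →
                  (∀ g → g ≢ ε → R (X g) (Y g)) → ∀ g → R (puncture X g) (puncture Y g)
  puncture-lift R R00 r g with g Fin.≟ ε
  ... | yes _   = R00
  ... | no g≢ε = r g g≢ε

  ∑≠ε-split : ∀ X → ∑≠ε X + X ε ≡ ∑ X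
  ∑≠ε-split X = begin
    ∑≠ε X + X ε                            ≡⟨ cong (∑≠ε X +_) (sym (∑-δ n ε X)) ⟩
    ∑≠ε X + ∑[ g < n ] atε g               ≡⟨ sym (∑-distrib-+ (puncture X) atε) ⟩
    ∑[ g < n ] (puncture X g + atε g)       ≡⟨ sum-cong-≗ recombine ⟩
    ∑ X                                    ∎
    where
    open ≡-Reasoning
    atε : Fin n → ℕ
    atε g = if does (g Fin.≟ ε) then X g else 0
    recombine : ∀ g → puncture X g + atε g ≡ X g
    recombine g with g Fin.≟ ε
    ... | yes _ = refl
    ... | no _  = +-identityʳ (X g)

  ∑≠ε-cong : ∀ {X Y} → (∀ g → g ≢ ε → X g ≡ Y g) → ∑≠ε X ≡ ∑≠ε Y
  ∑≠ε-cong e = sum-cong-≗ (puncture-lift _≡_ refl e)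

  ∑≠ε-mono : ∀ {X Y} → (∀ g → g ≢ ε → X g ≤ Y g) → ∑≠ε X ≤ ∑≠ε Y
  ∑≠ε-mono le = ∑-mono-≤ n (puncture-lift _≤_ z≤n le)

  ∑≠ε-tight : ∀ {X Y} → (∀ g → g ≢ ε → X g ≤ Y g) → ∑≠ε X ≡ ∑≠ε Y →
              ∀ g → g ≢ ε → X g ≡ Y g
  ∑≠ε-tight {X} {Y} le eq g g≢ε = begin
    X g           ≡⟨ sym (puncture-≢ X g≢ε) ⟩
    puncture X g  ≡⟨ ∑-tight n (puncture-lift _≤_ z≤n le) eq g ⟩
    puncture Y g  ≡⟨ puncture-≢ Y g≢ε ⟩
    Y g           ∎
    where open ≡-Reasoning

  ∑≠ε-distrib-+ : ∀ X Y → ∑≠ε (λ g → X g + Y g) ≡ ∑≠ε X + ∑≠ε Y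
  ∑≠ε-distrib-+ X Y = trans (sum-cong-≗ split) (∑-distrib-+ (puncture X) (puncture Y))
    where
    split : ∀ g → puncture (λ g → X g + Y g) g ≡ puncture X g + puncture Y g
    split g with isNotε g
    ... | true  = refl
    ... | false = refl

  ∑≠ε-one : ∑≠ε (λ _ → 1) + 1 ≡ n
  ∑≠ε-one = trans (∑≠ε-split (λ _ → 1)) (trans (∑-const n 1) (*-identityʳ n))

-- If row g has
-- P g entries +1, then |Σ_k ψ(g,k)| = |P g - (n - P g)| = 2 |P g - c|;
-- we call |P g - c| the deviation of row g, so RE(M_ψ) = 2 Σ_{g≠ε} deviation g.
module RowStatistics {n : ℕ} (_∙_ : Fin n → Fin n → Fin n) (ε : Fin n)
                     (ψ : Fin n → Fin n → Sign) (c : ℕ) (n≡2c : n ≡ 2 * c) where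

  open Punctured ε public

  P : Fin n → ℕ
  P g = plusCount (ψ g)

  deviation : Fin n → ℕ
  deviation g = ∣ P g - c ∣

  ∣rowSum∣≡2*deviation : ∀ g → ℤ.∣ rowSum _∙_ ε ψ g ∣ ≡ 2 * deviation g
  ∣rowSum∣≡2*deviation g = begin
    ℤ.∣ rowSum _∙_ ε ψ g ∣
      ≡⟨ cong (ℤ.∣_∣ ∘ foldr ℤ._+_ (ℤ.+ 0)) (List.map-tabulate id (entry _∙_ ε ψ g)) ⟩
    ℤ.∣ foldr ℤ._+_ (ℤ.+ 0) (tabulate (λ k → ψ g k ◃ 1)) ∣
      ≡⟨ cong ℤ.∣_∣ (signSum n (ψ g)) ⟩
    ℤ.∣ P g ⊖ M ∣
      ≡⟨ ∣⊖∣≡∣-∣ (P g) M ⟩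
    ∣ P g - M ∣
      ≡⟨ sym (∣m+n-m+o∣≡∣n-o∣ (P g) (P g) M) ⟩
    ∣ P g + P g - P g + M ∣
      ≡⟨ cong₂ ∣_-_∣ (cong (P g +_) (sym (+-identityʳ (P g)))) (trans (plusCount+minusCount (ψ g)) n≡2c) ⟩
    ∣ 2 * P g - 2 * c ∣
      ≡⟨ sym (*-distribˡ-∣-∣ 2 (P g) c) ⟩
    2 * deviation g ∎
    where
    open ≡-Reasoning
    M : ℕ
    M = minusCount (ψ g)

  RE≡2*∑deviation : RE _∙_ ε ψ ≡ 2 * ∑≠ε deviation
  RE≡2*∑deviation = begin
    RE _∙_ ε ψ
      ≡⟨ sum-filter-tabulate n isNotε (λ g → ℤ.∣ rowSum _∙_ ε ψ g ∣) id ⟩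
    ∑[ g < n ] (if isNotε g then ℤ.∣ rowSum _∙_ ε ψ g ∣ else 0)
      ≡⟨ sum-cong-≗ (λ g → double (isNotε g) g) ⟩
    ∑[ g < n ] (2 * puncture deviation g)
      ≡⟨ sym (*-distribˡ-sum 2 (puncture deviation)) ⟩
    2 * ∑≠ε deviation ∎
    where
    open ≡-Reasoning
    double : ∀ b g → (if b then ℤ.∣ rowSum _∙_ ε ψ g ∣ else 0) ≡ 2 * (if b then deviation g else 0)
    double true  g = ∣rowSum∣≡2*deviation g
    double false g = refl

  balanced⇒minusCount≡c : ∀ g → deviation g ≡ 0 → minusCount (ψ g) ≡ c
  balanced⇒minusCount≡c g balanced = +-cancelˡ-≡ c (minusCount (ψ g)) c (begin
    c + minusCount (ψ g)   ≡⟨ cong (_+ minusCount (ψ g)) (sym (∣m-n∣≡0⇒m≡n balanced)) ⟩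
    P g + minusCount (ψ g) ≡⟨ plusCount+minusCount (ψ g) ⟩
    n                      ≡⟨ n≡2c ⟩
    2 * c                  ≡⟨ cong (c +_) (+-identityʳ c) ⟩
    c + c                  ∎)
    where open ≡-Reasoning

module GroupFacts {n : ℕ} {_∙_ : Fin n → Fin n → Fin n} {ε : Fin n} {_⁻¹ : Fin n → Fin n}
                  (isGroup : IsGroup _≡_ _∙_ ε _⁻¹) where

  private
    G : Group _ _
    G = record { isGroup = isGroup }

  open GroupProperties G public using (\\-leftDividesˡ; \\-leftDividesʳ; x∙y⁻¹≈ε⇒x≈y; x≈y⇒x∙y⁻¹≈ε)

  left-solve : ∀ g k h → g ∙ k ≡ h → k ≡ (g ⁻¹) ∙ h
  left-solve g k h gk≡h = trans (sym (\\-leftDividesʳ g k)) (cong ((g ⁻¹) ∙_) gk≡h)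

  -- left translations permute the group, so they preserve sums over it
  ∑-translate : ∀ g (F : Fin n → ℕ) → ∑[ h < n ] F (g ∙ h) ≡ ∑ F
  ∑-translate g = ∑-bijection n (g ∙_) ((g ⁻¹) ∙_) (\\-leftDividesˡ g) (\\-leftDividesʳ g)

  ∑-translate⁻¹ : ∀ g (F : Fin n → ℕ) → ∑[ h < n ] F ((g ⁻¹) ∙ h) ≡ ∑ F
  ∑-translate⁻¹ g = ∑-bijection n ((g ⁻¹) ∙_) (g ∙_) (\\-leftDividesʳ g) (\\-leftDividesˡ g)

  -- A homomorphism χ to (Bool, xor) is either trivial or takes the value
  -- false exactly as often as true (translate by an a with χ a = true).
  character-balance : (χ : Fin n → Bool) → (∀ g h → χ (g ∙ h) ≡ χ g xor χ h) →
                      ∑[ g < n ] 𝟙 (not (χ g)) ≡ n ⊎ 2 * ∑[ g < n ] 𝟙 (not (χ g)) ≡ n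
  character-balance χ hom with any? (λ a → χ a Bool.≟ true)
  ... | yes (a , χa≡true) = inj₂ (begin
    2 * K₀     ≡⟨ cong (K₀ +_) (+-identityʳ K₀) ⟩
    K₀ + K₀    ≡⟨ cong (_+ K₀) K₀≡K₁ ⟩
    K₁ + K₀    ≡⟨ K₁+K₀≡n ⟩
    n          ∎)
    where
    open ≡-Reasoning
    K₀ K₁ : ℕ
    K₀ = ∑[ g < n ] 𝟙 (not (χ g))
    K₁ = ∑[ g < n ] 𝟙 (χ g)
    K₁+K₀≡n : K₁ + K₀ ≡ n
    K₁+K₀≡n = ∑-𝟙-complement n χ
    K₀≡K₁ : K₀ ≡ K₁
    K₀≡K₁ = trans (sym (∑-translate a (𝟙 ∘ not ∘ χ)))
              (sum-cong-≗ (λ g → trans (cong (𝟙 ∘ not) (trans (hom a g) (cong (_xor χ g) χa≡true)))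
                                       (cong 𝟙 (not-involutive (χ g)))))
  ... | no noTrue = inj₁ (trans (sum-cong-≗ (λ g → cong (𝟙 ∘ not) (χ≡false g)))
                                (trans (∑-const n 1) (*-identityʳ n)))
    where
    χ≡false : ∀ g → χ g ≡ false
    χ≡false g with χ g in χg
    ... | true  = ⊥-elim (noTrue (g , χg))
    ... | false = refl

-- A normalized cocycle on a group: ψ(g,1) = ψ(1,g) = 1, and for even |G|
-- the parity of the number of -1 entries in row g is a homomorphism G → Z/2
-- (sum the cocycle identity over k and reindex k ↦ hk).
module CocycleRows {n : ℕ} {_∙_ : Fin n → Fin n → Fin n} {ε : Fin n} {_⁻¹ : Fin n → Fin n}
                   (isGroup : IsGroup _≡_ _∙_ ε _⁻¹)
                   (ψ : Fin n → Fin n → Sign) (isCocycle : IsCocycle _∙_ ε ψ) where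

  open IsGroup isGroup using (identityˡ; identityʳ)
  open GroupFacts isGroup using (∑-translate)
  open ≡-Reasoning

  cocycle : ∀ g h k → ψ g h S.* ψ (g ∙ h) k ≡ ψ g (h ∙ k) S.* ψ h k
  cocycle = proj₁ isCocycle

  normalized : ψ ε ε ≡ S.+
  normalized = proj₂ isCocycle

  ψ-ε-right : ∀ g → ψ g ε ≡ S.+
  ψ-ε-right g = SP.*-cancelˡ-≡ (ψ g ε) (ψ g ε) S.+ (begin
    ψ g ε S.* ψ g ε          ≡⟨ cong (λ x → ψ g ε S.* ψ x ε) (sym (identityʳ g)) ⟩
    ψ g ε S.* ψ (g ∙ ε) ε    ≡⟨ cocycle g ε ε ⟩
    ψ g (ε ∙ ε) S.* ψ ε ε    ≡⟨ cong₂ (λ x y → ψ g x S.* y) (identityʳ ε) normalized ⟩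
    ψ g ε S.* S.+            ∎)

  ψ-ε-left : ∀ k → ψ ε k ≡ S.+
  ψ-ε-left k = begin
    ψ ε k                    ≡⟨ cong₂ (λ x y → x S.* ψ y k) (sym normalized) (sym (identityˡ ε)) ⟩
    ψ ε ε S.* ψ (ε ∙ ε) k    ≡⟨ cocycle ε ε k ⟩
    ψ ε (ε ∙ k) S.* ψ ε k    ≡⟨ cong (λ x → ψ ε x S.* ψ ε k) (identityˡ k) ⟩
    ψ ε k S.* ψ ε k          ≡⟨ SP.s*s≡+ (ψ ε k) ⟩
    S.+                      ∎

  rowParity : Fin n → Bool
  rowParity g = odd (minusCount (ψ g))

  rowParity-ε : rowParity ε ≡ false
  rowParity-ε = cong odd (trans (sum-cong-≗ (λ k → cong minus (ψ-ε-left k))) (∑-zero n))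

  rowParity-hom : odd n ≡ false → ∀ g h → rowParity (g ∙ h) ≡ rowParity g xor rowParity h
  rowParity-hom n-even g h = begin
    odd (M (g ∙ h))
      ≡⟨ cong (_xor odd (M (g ∙ h))) (sym n*a-even) ⟩
    odd (n * minus a) xor odd (M (g ∙ h))
      ≡⟨ sym (odd-+ (n * minus a) (M (g ∙ h))) ⟩
    odd (n * minus a + M (g ∙ h))
      ≡⟨ cong (λ x → odd (x + M (g ∙ h))) (sym (∑-const n (minus a))) ⟩
    odd (∑[ k < n ] minus a + M (g ∙ h))
      ≡⟨ cong odd (sym (∑-distrib-+ (λ _ → minus a) (minus ∘ ψ (g ∙ h)))) ⟩
    odd (∑[ k < n ] (minus a + minus (ψ (g ∙ h) k)))
      ≡⟨ odd-∑-cong n (λ k → minus-*-parity a (ψ (g ∙ h) k)) ⟩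
    odd (∑[ k < n ] minus (a S.* ψ (g ∙ h) k))
      ≡⟨ cong odd (sum-cong-≗ (λ k → cong minus (cocycle g h k))) ⟩
    odd (∑[ k < n ] minus (ψ g (h ∙ k) S.* ψ h k))
      ≡⟨ sym (odd-∑-cong n (λ k → minus-*-parity (ψ g (h ∙ k)) (ψ h k))) ⟩
    odd (∑[ k < n ] (minus (ψ g (h ∙ k)) + minus (ψ h k)))
      ≡⟨ cong odd (∑-distrib-+ (λ k → minus (ψ g (h ∙ k))) (minus ∘ ψ h)) ⟩
    odd (∑[ k < n ] minus (ψ g (h ∙ k)) + M h)
      ≡⟨ cong (λ x → odd (x + M h)) (∑-translate h (minus ∘ ψ g)) ⟩
    odd (M g + M h)
      ≡⟨ odd-+ (M g) (M h) ⟩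
    rowParity g xor rowParity h ∎
    where
    a : Sign
    a = ψ g h
    M : Fin n → ℕ
    M g = minusCount (ψ g)
    n*a-even : odd (n * minus a) ≡ false
    n*a-even = trans (odd-* n (minus a)) (cong (_∧ odd (minus a)) n-even)

order≡2c : ∀ t → 4 * t + 2 ≡ 2 * (2 * t + 1)
order≡2c = solve-∀

4t≡2*2t : ∀ t → 4 * t ≡ 2 * (2 * t)
4t≡2*2t = solve-∀

4t+1≡2t+[1+2t] : ∀ t → 4 * t + 1 ≡ 2 * t + suc (2 * t)
4t+1≡2t+[1+2t] = solve-∀

4t+1≡c+2t : ∀ t → 4 * t + 1 ≡ 2 * t + 1 + 2 * t
4t+1≡c+2t = solve-∀

odd-c : ∀ t → odd (2 * t + 1) ≡ true
odd-c t rewrite odd-+ (2 * t) 1 | odd-* 2 t = refl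

odd-order : ∀ t → odd (4 * t + 2) ≡ false
odd-order t rewrite order≡2c t | odd-* 2 (2 * t + 1) = refl

module QuasiOrthogonality (t : ℕ) (_∙_ : Fin (4 * t + 2) → Fin (4 * t + 2) → Fin (4 * t + 2))
                          (ε : Fin (4 * t + 2)) (ψ : Fin (4 * t + 2) → Fin (4 * t + 2) → Sign) where

  open RowStatistics _∙_ ε ψ (2 * t + 1) (order≡2c t) public

  quasiOrthogonal⇒ : QuasiOrthogonal _∙_ ε t ψ → ∑≠ε deviation ≡ 2 * t
  quasiOrthogonal⇒ qo = *-cancelˡ-≡ (∑≠ε deviation) (2 * t) 2
                          (trans (sym RE≡2*∑deviation) (trans qo (4t≡2*2t t)))

  quasiOrthogonal⇐ : ∑≠ε deviation ≡ 2 * t → QuasiOrthogonal _∙_ ε t ψ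
  quasiOrthogonal⇐ ∑dev≡2t = trans RE≡2*∑deviation (trans (cong (2 *_) ∑dev≡2t) (sym (4t≡2*2t t)))

-- Let ψ be a quasi-orthogonal cocycle on G, |G| = 4t + 2.  Each
-- nonidentity row of even parity has deviation ≥ 1; the parity character
-- cannot be trivial (4t + 1 > 2t), so exactly c = 2t + 1 rows are even and
-- the bound is attained: odd rows are balanced (P g = 2t + 1) and even
-- nonidentity rows have P g = 2t ± 1.  In E_ψ, |T ∩ (1,g)T| = P g, so the
-- odd rows give the set S of a quasi-Hadamard subset.
module QuasiHadamardFromCocycle
  (t : ℕ) (_∙_ : Fin (4 * t + 2) → Fin (4 * t + 2) → Fin (4 * t + 2))
  (ε : Fin (4 * t + 2)) (_⁻¹ : Fin (4 * t + 2) → Fin (4 * t + 2))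
  (isGroup : IsGroup _≡_ _∙_ ε _⁻¹)
  (ψ : Fin (4 * t + 2) → Fin (4 * t + 2) → Sign) (isCocycle : IsCocycle _∙_ ε ψ)
  (quasiOrthogonal : QuasiOrthogonal _∙_ ε t ψ) where

  open QuasiOrthogonality t _∙_ ε ψ
  open CocycleRows isGroup ψ isCocycle
  open GroupFacts isGroup using (left-solve; ∑-translate⁻¹; \\-leftDividesˡ; character-balance)

  n : ℕ
  n = 4 * t + 2

  ∑deviation≡2t : ∑≠ε deviation ≡ 2 * t
  ∑deviation≡2t = quasiOrthogonal⇒ quasiOrthogonal

  even : Fin n → ℕ
  even g = 𝟙 (not (rowParity g))

  -- a balanced row has c entries -1, and c is odd
  even⇒unbalanced : ∀ g → rowParity g ≡ false → deviation g ≢ 0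
  even⇒unbalanced g even-g balanced =
    true≢false (trans (sym (odd-c t)) (trans (cong odd (sym (balanced⇒minusCount≡c g balanced))) even-g))

  even≤deviation : ∀ g → even g ≤ deviation g
  even≤deviation g with rowParity g in parity
  ... | true  = z≤n
  ... | false = n≢0⇒n>0 (even⇒unbalanced g parity)

  -- the identity row is even (it has no -1 entries)
  ∑≠ε-even : ∑≠ε even + 1 ≡ ∑[ g < n ] even g
  ∑≠ε-even = trans (cong (∑≠ε even +_) (cong (𝟙 ∘ not) (sym rowParity-ε))) (∑≠ε-split even)

  ∑≠ε-even≤2t : ∑≠ε even ≤ 2 * t
  ∑≠ε-even≤2t = subst (∑≠ε even ≤_) ∑deviation≡2t (∑≠ε-mono (λ g _ → even≤deviation g))

  -- exactly half of the rows are even: the parity character cannot be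
  -- trivial, as then all 4t + 1 nonidentity rows would have deviation ≥ 1
  evenRows≡c : ∑[ g < n ] even g ≡ 2 * t + 1
  evenRows≡c with character-balance rowParity (rowParity-hom (odd-order t))
  ... | inj₂ 2*evenRows≡n = *-cancelˡ-≡ _ (2 * t + 1) 2 (trans 2*evenRows≡n (order≡2c t))
  ... | inj₁ evenRows≡n   = ⊥-elim (m+1+n≰m (2 * t) (subst (_≤ 2 * t) (4t+1≡2t+[1+2t] t) 4t+1≤2t))
    where
    ∑≠ε-even≡4t+1 : ∑≠ε even ≡ 4 * t + 1
    ∑≠ε-even≡4t+1 = +-cancelʳ-≡ 1 (∑≠ε even) (4 * t + 1)
                      (trans ∑≠ε-even (trans evenRows≡n (sym (+-assoc (4 * t) 1 1))))
    4t+1≤2t : 4 * t + 1 ≤ 2 * t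
    4t+1≤2t = subst (_≤ 2 * t) ∑≠ε-even≡4t+1 ∑≠ε-even≤2t

  oddRows≡c : ∑[ g < n ] 𝟙 (rowParity g) ≡ 2 * t + 1
  oddRows≡c = +-cancelʳ-≡ (2 * t + 1) _ (2 * t + 1)
    (trans (cong (∑[ g < n ] 𝟙 (rowParity g) +_) (sym evenRows≡c))
    (trans (∑-𝟙-complement n rowParity) (trans (order≡2c t) (cong (2 * t + 1 +_) (+-identityʳ (2 * t + 1))))))

  deviation≡even : ∀ g → g ≢ ε → deviation g ≡ even g
  deviation≡even g g≢ε = sym (∑≠ε-tight (λ g _ → even≤deviation g) ∑≠ε-even≡∑deviation g g≢ε)
    where
    ∑≠ε-even≡∑deviation : ∑≠ε even ≡ ∑≠ε deviation
    ∑≠ε-even≡∑deviation = trans (+-cancelʳ-≡ 1 (∑≠ε even) (2 * t) (trans ∑≠ε-even evenRows≡c))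
                                (sym ∑deviation≡2t)

  oddRow-balanced : ∀ g → g ≢ ε → rowParity g ≡ true → P g ≡ 2 * t + 1
  oddRow-balanced g g≢ε odd-g = ∣m-n∣≡0⇒m≡n (trans (deviation≡even g g≢ε) (cong (𝟙 ∘ not) odd-g))

  evenRow-nearlyBalanced : ∀ g → g ≢ ε → rowParity g ≡ false → P g ≡ 2 * t ⊎ P g ≡ 2 * t + 2
  evenRow-nearlyBalanced g g≢ε even-g
    with ∣-∣≡1⇒ (P g) (2 * t + 1) (trans (deviation≡even g g≢ε) (cong (𝟙 ∘ not) even-g))
  ... | inj₁ 1+P≡c = inj₁ (suc-injective (trans 1+P≡c (+-comm (2 * t) 1)))
  ... | inj₂ P≡1+c = inj₂ (trans P≡1+c (sym (+-suc (2 * t) 1)))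

  E : Set
  E = Sign × Fin n

  elems : List E
  elems = Eψ-elems n

  _·_ : E → E → E
  _·_ = Eψ-mul _∙_ ψ

  e z : E
  e = (S.+ , ε)
  z = (S.- , ε)

  T : E → Bool
  T x = isPlus (proj₁ x)

  countE : ∀ Q → count Eψ-≟ elems _·_ e z Q ≡ ∑[ g < n ] 𝟙 (Q (S.+ , g)) + ∑[ g < n ] 𝟙 (Q (S.- , g))
  countE Q = trans (count-++ Q (map (S.+ ,_) (allFin n)) (map (S.- ,_) (allFin n) ++ []))
               (cong₂ _+_ (sheet S.+) (trans (count-++ Q (map (S.- ,_) (allFin n)) [])
                                              (trans (+-identityʳ _) (sheet S.-))))
    where
    sheet : ∀ s → length (filterᵇ Q (map (s ,_) (allFin n))) ≡ ∑[ g < n ] 𝟙 (Q (s , g))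
    sheet s = trans (cong (length ∘ filterᵇ Q) (List.map-tabulate id (s ,_))) (count-tabulate n Q (s ,_))

  inTranslate-T : ∀ g h → inTranslate Eψ-≟ elems _·_ e z T (S.+ , g) (S.+ , h) ≡ isPlus (ψ g ((g ⁻¹) ∙ h))
  inTranslate-T g h = bool-ext into onto
    where
    into : inTranslate Eψ-≟ elems _·_ e z T (S.+ , g) (S.+ , h) ≡ true → isPlus (ψ g ((g ⁻¹) ∙ h)) ≡ true
    into member with any-elim _ elems member
    ... | (S.+ , k) , witness with does-true (Eψ-≟ (S.+ , h) (ψ g k , g ∙ k)) witness
    ...   | h≡gk = subst (λ k′ → isPlus (ψ g k′) ≡ true) (left-solve g k h (sym (cong proj₂ h≡gk)))
                         (cong isPlus (sym (cong proj₁ h≡gk)))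
    onto : isPlus (ψ g ((g ⁻¹) ∙ h)) ≡ true → inTranslate Eψ-≟ elems _·_ e z T (S.+ , g) (S.+ , h) ≡ true
    onto plus-entry = any-intro _ (∈-++⁺ˡ (∈-map⁺ (S.+ ,_) (∈-allFin ((g ⁻¹) ∙ h))))
      (dec-true (Eψ-≟ (S.+ , h) (ψ g ((g ⁻¹) ∙ h) , g ∙ ((g ⁻¹) ∙ h)))
                (cong₂ _,_ (sym (isPlus⇒+ plus-entry)) (sym (\\-leftDividesˡ g h))))

  interSize-T : ∀ g → interSize Eψ-≟ elems _·_ e z T (S.+ , g) ≡ P g
  interSize-T g = begin
    interSize Eψ-≟ elems _·_ e z T (S.+ , g)
      ≡⟨ countE _ ⟩
    ∑[ h < n ] 𝟙 (inTranslate Eψ-≟ elems _·_ e z T (S.+ , g) (S.+ , h)) + ∑[ h < n ] 0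
      ≡⟨ cong₂ _+_ (sum-cong-≗ (λ h → cong 𝟙 (inTranslate-T g h))) (∑-zero n) ⟩
    ∑[ h < n ] plus (ψ g ((g ⁻¹) ∙ h)) + 0
      ≡⟨ +-identityʳ _ ⟩
    ∑[ h < n ] plus (ψ g ((g ⁻¹) ∙ h))
      ≡⟨ ∑-translate⁻¹ g (plus ∘ ψ g) ⟩
    P g ∎
    where open ≡-Reasoning

  transversal : IsTransversal Eψ-≟ elems _·_ e z T
  transversal (u , g) rewrite ψ-ε-right g with u
  ... | S.+ = refl
  ... | S.- = refl

  inZ-≢ : ∀ {g} → g ≢ ε → inZ Eψ-≟ elems _·_ e z (S.+ , g) ≡ false
  inZ-≢ {g} g≢ε rewrite dec-false (Eψ-≟ (S.+ , g) e) (g≢ε ∘ cong proj₂)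
                      | dec-false (Eψ-≟ (S.+ , g) z) (λ ()) = refl

  inZ-e : inZ Eψ-≟ elems _·_ e z e ≡ true
  inZ-e rewrite dec-true (Eψ-≟ e e) refl = refl

  oddRow≢ε : ∀ g → rowParity g ≡ true → g ≢ ε
  oddRow≢ε g odd-g refl = true≢false (trans (sym odd-g) rowParity-ε)

  S : E → Bool
  S x = isPlus (proj₁ x) ∧ rowParity (proj₂ x)

  quasiHadamard : IsQuasiHadamard Eψ-≟ elems _·_ e z t T
  quasiHadamard = transversal , S , S⊆T∖Z , |S|≡c , S-intersections , T∖S-intersections
    where
    S⊆T∖Z : ∀ x → S x ≡ true → T x ≡ true × inZ Eψ-≟ elems _·_ e z x ≡ false
    S⊆T∖Z (S.+ , g) odd-g = refl , inZ-≢ (oddRow≢ε g odd-g)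
    |S|≡c : count Eψ-≟ elems _·_ e z S ≡ 2 * t + 1
    |S|≡c = trans (countE S) (trans (cong (∑[ g < n ] 𝟙 (rowParity g) +_) (∑-zero n)) (trans (+-identityʳ _) oddRows≡c))
    S-intersections : ∀ x → S x ≡ true → interSize Eψ-≟ elems _·_ e z T x ≡ 2 * t + 1
    S-intersections (S.+ , g) odd-g = trans (interSize-T g) (oddRow-balanced g (oddRow≢ε g odd-g) odd-g)
    T∖S-intersections : ∀ x → T x ≡ true → S x ≡ false → inZ Eψ-≟ elems _·_ e z x ≡ false →
                        interSize Eψ-≟ elems _·_ e z T x ≡ 2 * t ⊎ interSize Eψ-≟ elems _·_ e z T x ≡ 2 * t + 2
    T∖S-intersections (S.+ , g) _ even-g notInZ
      with evenRow-nearlyBalanced g (λ { refl → true≢false (trans (sym inZ-e) notInZ) }) even-g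
    ... | inj₁ P≡2t   = inj₁ (trans (interSize-T g) P≡2t)
    ... | inj₂ P≡2t+2 = inj₂ (trans (interSize-T g) P≡2t+2)

-- Let T ∋ 1 be a quasi-Hadamard subset of E and σ : G → T the
-- coset-representative map.  Since T meets each coset of ⟨-1⟩ once, every
-- y ∈ T is σ(π y); hence σ(h) ∈ σ(g)T iff σ(g)σ(g⁻¹h) = σ(h), i.e. iff
-- ψ_T(g, g⁻¹h) = 1, and |T ∩ σ(g)T| = P g.  The quasi-Hadamard conditions
-- then give deviation 0 on the 2t + 1 rows of S and deviation 1 on the other
-- 2t nonidentity rows: the deviations add up to 2t.
module QuasiOrthogonalFromQuasiHadamard
  (t : ℕ) (_∙_ : Fin (4 * t + 2) → Fin (4 * t + 2) → Fin (4 * t + 2))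
  (ε : Fin (4 * t + 2)) (_⁻¹ : Fin (4 * t + 2) → Fin (4 * t + 2))
  (isGroup : IsGroup _≡_ _∙_ ε _⁻¹)
  (_·_ : Fin (8 * t + 4) → Fin (8 * t + 4) → Fin (8 * t + 4))
  (eE : Fin (8 * t + 4)) (_⁻¹ᴱ : Fin (8 * t + 4) → Fin (8 * t + 4))
  (isGroupᴱ : IsGroup _≡_ _·_ eE _⁻¹ᴱ)
  (m : Fin (8 * t + 4)) (π : Fin (8 * t + 4) → Fin (4 * t + 2))
  (π-hom : ∀ x y → π (x · y) ≡ π x ∙ π y)
  (kernel⊆ : ∀ x → π x ≡ ε → x ≡ eE ⊎ x ≡ m)
  (⊆kernel : ∀ x → x ≡ eE ⊎ x ≡ m → π x ≡ ε)
  (T : Fin (8 * t + 4) → Bool)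
  (quasiHadamard : IsQuasiHadamard Fin._≟_ (allFin (8 * t + 4)) _·_ eE m t T)
  (eE∈T : T eE ≡ true)
  (σ : Fin (4 * t + 2) → Fin (8 * t + 4))
  (σ∈T : ∀ g → T (σ g) ≡ true) (πσ : ∀ g → π (σ g) ≡ g) where

  n N : ℕ
  n = 4 * t + 2
  N = 8 * t + 4

  ψT : Fin n → Fin n → Sign
  ψT = ψ-of _∙_ _·_ eE _⁻¹ᴱ σ

  open QuasiOrthogonality t _∙_ ε ψT
  open IsGroup isGroup using (inverseˡ)
  open GroupFacts isGroup using (left-solve; \\-leftDividesˡ; ∑-translate⁻¹)
  module Eᴳ = GroupFacts isGroupᴱ

  transversal : IsTransversal Fin._≟_ (allFin N) _·_ eE m T
  transversal = proj₁ quasiHadamard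

  S : Fin N → Bool
  S = proj₁ (proj₂ quasiHadamard)

  S⊆T∖Z : ∀ x → S x ≡ true → T x ≡ true × inZ Fin._≟_ (allFin N) _·_ eE m x ≡ false
  S⊆T∖Z = proj₁ (proj₂ (proj₂ quasiHadamard))

  |S|≡c : count Fin._≟_ (allFin N) _·_ eE m S ≡ 2 * t + 1
  |S|≡c = proj₁ (proj₂ (proj₂ (proj₂ quasiHadamard)))

  S-intersections : ∀ x → S x ≡ true → interSize Fin._≟_ (allFin N) _·_ eE m T x ≡ 2 * t + 1
  S-intersections = proj₁ (proj₂ (proj₂ (proj₂ (proj₂ quasiHadamard))))

  T∖S-intersections : ∀ x → T x ≡ true → S x ≡ false → inZ Fin._≟_ (allFin N) _·_ eE m x ≡ false →
    interSize Fin._≟_ (allFin N) _·_ eE m T x ≡ 2 * t ⊎ interSize Fin._≟_ (allFin N) _·_ eE m T x ≡ 2 * t + 2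
  T∖S-intersections = proj₂ (proj₂ (proj₂ (proj₂ (proj₂ quasiHadamard))))

  π-quotient : ∀ y → π ((σ (π y) ⁻¹ᴱ) · y) ≡ ε
  π-quotient y = trans (left-solve (π y) (π q) (π y) πy≡πy∙πq) (inverseˡ (π y))
    where
    q : Fin N
    q = (σ (π y) ⁻¹ᴱ) · y
    πy≡πy∙πq : π y ∙ π q ≡ π y
    πy≡πy∙πq = begin
      π y ∙ π q             ≡⟨ cong (_∙ π q) (sym (πσ (π y))) ⟩
      π (σ (π y)) ∙ π q     ≡⟨ sym (π-hom (σ (π y)) q) ⟩
      π (σ (π y) · q)       ≡⟨ cong π (Eᴳ.\\-leftDividesˡ (σ (π y)) y) ⟩
      π y                   ∎
      where open ≡-Reasoning

  -- every element of T is the representative of its own coset, as T is a transversal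
  T-representative : ∀ y → T y ≡ true → y ≡ σ (π y)
  T-representative y y∈T with kernel⊆ ((σ (π y) ⁻¹ᴱ) · y) (π-quotient y)
  ... | inj₁ q≡eE = begin
    y                                 ≡⟨ sym (Eᴳ.\\-leftDividesˡ (σ (π y)) y) ⟩
    σ (π y) · ((σ (π y) ⁻¹ᴱ) · y)     ≡⟨ cong (σ (π y) ·_) q≡eE ⟩
    σ (π y) · eE                      ≡⟨ IsGroup.identityʳ isGroupᴱ (σ (π y)) ⟩
    σ (π y)                           ∎
    where open ≡-Reasoning
  ... | inj₂ q≡m = ⊥-elim (true≢false (begin
    true                              ≡⟨ sym (transversal (σ (π y))) ⟩
    T (σ (π y)) xor T (σ (π y) · m)   ≡⟨ cong₂ _xor_ (σ∈T (π y)) (cong T ym≡y) ⟩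
    true xor T y                      ≡⟨ cong not y∈T ⟩
    false                             ∎))
    where
    open ≡-Reasoning
    ym≡y : σ (π y) · m ≡ y
    ym≡y = trans (cong (σ (π y) ·_) (sym q≡m)) (Eᴳ.\\-leftDividesˡ (σ (π y)) y)

  ψT-plus⇒ : ∀ g k → isPlus (ψT g k) ≡ true → σ g · σ k ≡ σ (g ∙ k)
  ψT-plus⇒ g k plus-entry = Eᴳ.x∙y⁻¹≈ε⇒x≈y _ _
    (does-true (((σ g · σ k) · (σ (g ∙ k) ⁻¹ᴱ)) Fin.≟ eE) (trans (sym (isPlus-if _)) plus-entry))

  ψT-plus⇐ : ∀ g k → σ g · σ k ≡ σ (g ∙ k) → isPlus (ψT g k) ≡ true
  ψT-plus⇐ g k σ-mult = trans (isPlus-if _)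
    (dec-true (((σ g · σ k) · (σ (g ∙ k) ⁻¹ᴱ)) Fin.≟ eE) (Eᴳ.x≈y⇒x∙y⁻¹≈ε σ-mult))

  I : Fin N → Fin N → Bool
  I = inTranslate Fin._≟_ (allFin N) _·_ eE m T

  inTranslate-σ : ∀ g h → I (σ g) (σ h) ≡ isPlus (ψT g ((g ⁻¹) ∙ h))
  inTranslate-σ g h = bool-ext into onto
    where
    into : I (σ g) (σ h) ≡ true → isPlus (ψT g ((g ⁻¹) ∙ h)) ≡ true
    into member with any-elim _ (allFin N) member
    ... | s , witness = subst (λ k′ → isPlus (ψT g k′) ≡ true) k≡g⁻¹h
                              (ψT-plus⇐ g k (trans (sym σh≡σgσk) (cong σ h≡gk)))
      where
      s∈T : T s ≡ true
      s∈T = ∧-conicalˡ (T s) _ witness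
      k : Fin n
      k = π s
      σh≡σgσk : σ h ≡ σ g · σ k
      σh≡σgσk = trans (does-true (σ h Fin.≟ (σ g · s)) (∧-conicalʳ (T s) _ witness)) (cong (σ g ·_) (T-representative s s∈T))
      h≡gk : h ≡ g ∙ k
      h≡gk = trans (sym (πσ h)) (trans (cong π σh≡σgσk) (trans (π-hom (σ g) (σ k)) (cong₂ _∙_ (πσ g) (πσ k))))
      k≡g⁻¹h : k ≡ (g ⁻¹) ∙ h
      k≡g⁻¹h = left-solve g k h (sym h≡gk)
    onto : isPlus (ψT g ((g ⁻¹) ∙ h)) ≡ true → I (σ g) (σ h) ≡ true
    onto plus-entry = any-intro (λ s → T s ∧ does (σ h Fin.≟ (σ g · s))) (∈-allFin (σ k))
      (trans (cong (_∧ does (σ h Fin.≟ (σ g · σ k))) (σ∈T k))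
             (dec-true (σ h Fin.≟ (σ g · σ k)) (sym (trans (ψT-plus⇒ g k plus-entry) (cong σ (\\-leftDividesˡ g h))))))
      where
      k : Fin n
      k = (g ⁻¹) ∙ h

  interSize-σ : ∀ g → interSize Fin._≟_ (allFin N) _·_ eE m T (σ g) ≡ P g
  interSize-σ g = begin
    interSize Fin._≟_ (allFin N) _·_ eE m T (σ g)
      ≡⟨ count-tabulate N (λ y → T y ∧ I (σ g) y) id ⟩
    ∑[ y < N ] 𝟙 (T y ∧ I (σ g) y)
      ≡⟨ ∑-section N n T σ π T-representative πσ _ (λ y y∉T → cong (λ b → 𝟙 (b ∧ I (σ g) y)) y∉T) ⟩
    ∑[ h < n ] 𝟙 (T (σ h) ∧ I (σ g) (σ h))
      ≡⟨ sum-cong-≗ (λ h → cong 𝟙 (trans (cong (_∧ I (σ g) (σ h)) (σ∈T h)) (inTranslate-σ g h))) ⟩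
    ∑[ h < n ] plus (ψT g ((g ⁻¹) ∙ h))
      ≡⟨ ∑-translate⁻¹ g (plus ∘ ψT g) ⟩
    P g ∎
    where open ≡-Reasoning

  σ-avoids-kernel : ∀ g → g ≢ ε → ∀ {x} → π x ≡ ε → σ g ≢ x
  σ-avoids-kernel g g≢ε πx≡ε σg≡x = g≢ε (trans (sym (πσ g)) (trans (cong π σg≡x) πx≡ε))

  inZ-σ : ∀ g → g ≢ ε → inZ Fin._≟_ (allFin N) _·_ eE m (σ g) ≡ false
  inZ-σ g g≢ε rewrite dec-false (σ g Fin.≟ eE) (σ-avoids-kernel g g≢ε (⊆kernel eE (inj₁ refl)))
                    | dec-false (σ g Fin.≟ m) (σ-avoids-kernel g g≢ε (⊆kernel m (inj₂ refl))) = refl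

  deviation≡notS : ∀ g → g ≢ ε → deviation g ≡ 𝟙 (not (S (σ g)))
  deviation≡notS g g≢ε with S (σ g) in σg∈S
  ... | true  = m≡n⇒∣m-n∣≡0 (trans (sym (interSize-σ g)) (S-intersections (σ g) σg∈S))
  ... | false with T∖S-intersections (σ g) (σ∈T g) σg∈S (inZ-σ g g≢ε)
  ...   | inj₁ |∩|≡2t   = trans (cong (λ x → ∣ x - 2 * t + 1 ∣) (trans (sym (interSize-σ g)) |∩|≡2t))
                                (subst (λ c → ∣ 2 * t - c ∣ ≡ 1) (+-comm 1 (2 * t)) (∣n-1+n∣≡1 (2 * t)))
  ...   | inj₂ |∩|≡2t+2 = trans (cong (λ x → ∣ x - 2 * t + 1 ∣) (trans (sym (interSize-σ g)) |∩|≡2t+2))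
                                (subst (λ x → ∣ x - 2 * t + 1 ∣ ≡ 1) (sym (+-suc (2 * t) 1)) (∣1+n-n∣≡1 (2 * t + 1)))

  S∌eE : S eE ≡ false
  S∌eE with S eE in eE∈S
  ... | false = refl
  ... | true  = ⊥-elim (true≢false (trans (sym eE∈Z) (proj₂ (S⊆T∖Z eE eE∈S))))
    where
    eE∈Z : inZ Fin._≟_ (allFin N) _·_ eE m eE ≡ true
    eE∈Z rewrite dec-true (eE Fin.≟ eE) refl = refl

  σε≡eE : σ ε ≡ eE
  σε≡eE = sym (trans (T-representative eE eE∈T) (cong σ (⊆kernel eE (inj₁ refl))))

  -- S ⊆ T, so counting S over E is counting representatives in S over G
  ∑-S≡c : ∑[ g < n ] 𝟙 (S (σ g)) ≡ 2 * t + 1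
  ∑-S≡c = begin
    ∑[ g < n ] 𝟙 (S (σ g)) ≡⟨ sym (∑-section N n T σ π T-representative πσ (𝟙 ∘ S) S-off-T) ⟩
    ∑[ y < N ] 𝟙 (S y)     ≡⟨ sym (count-tabulate N S id) ⟩
    count Fin._≟_ (allFin N) _·_ eE m S ≡⟨ |S|≡c ⟩
    2 * t + 1              ∎
    where
    open ≡-Reasoning
    S-off-T : ∀ y → T y ≡ false → 𝟙 (S y) ≡ 0
    S-off-T y y∉T with S y in y∈S
    ... | false = refl
    ... | true  = ⊥-elim (true≢false (trans (sym (proj₁ (S⊆T∖Z y y∈S))) y∉T))

  ∑≠ε-S≡c : ∑≠ε (𝟙 ∘ S ∘ σ) ≡ 2 * t + 1
  ∑≠ε-S≡c = begin
    ∑≠ε (𝟙 ∘ S ∘ σ)                        ≡⟨ sym (+-identityʳ _) ⟩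
    ∑≠ε (𝟙 ∘ S ∘ σ) + 0                    ≡⟨ cong (λ b → ∑≠ε (𝟙 ∘ S ∘ σ) + 𝟙 b) (sym (trans (cong S σε≡eE) S∌eE)) ⟩
    ∑≠ε (𝟙 ∘ S ∘ σ) + 𝟙 (S (σ ε))          ≡⟨ ∑≠ε-split (𝟙 ∘ S ∘ σ) ⟩
    ∑[ g < n ] 𝟙 (S (σ g))                 ≡⟨ ∑-S≡c ⟩
    2 * t + 1                              ∎
    where open ≡-Reasoning

  ∑≠ε-notS≡2t : ∑≠ε (𝟙 ∘ not ∘ S ∘ σ) ≡ 2 * t
  ∑≠ε-notS≡2t = +-cancelˡ-≡ (2 * t + 1) _ (2 * t) (begin
    2 * t + 1 + ∑≠ε (𝟙 ∘ not ∘ S ∘ σ)                ≡⟨ cong (_+ ∑≠ε (𝟙 ∘ not ∘ S ∘ σ)) (sym ∑≠ε-S≡c) ⟩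
    ∑≠ε (𝟙 ∘ S ∘ σ) + ∑≠ε (𝟙 ∘ not ∘ S ∘ σ)         ≡⟨ sym (∑≠ε-distrib-+ (𝟙 ∘ S ∘ σ) (𝟙 ∘ not ∘ S ∘ σ)) ⟩
    ∑≠ε (λ g → 𝟙 (S (σ g)) + 𝟙 (not (S (σ g))))     ≡⟨ ∑≠ε-cong (λ g _ → 𝟙-not (S (σ g))) ⟩
    ∑≠ε (λ _ → 1)                                   ≡⟨ +-cancelʳ-≡ 1 _ (4 * t + 1) (trans ∑≠ε-one (sym (+-assoc (4 * t) 1 1))) ⟩
    4 * t + 1                                       ≡⟨ 4t+1≡c+2t t ⟩
    2 * t + 1 + 2 * t                               ∎)
    where open ≡-Reasoning

  quasiOrthogonal : QuasiOrthogonal _∙_ ε t ψT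
  quasiOrthogonal = quasiOrthogonal⇐ (trans (∑≠ε-cong deviation≡notS) ∑≠ε-notS≡2t)

theorem1 :
    (t : ℕ) → 1 ≤ t →
    -- G = (Fin (4t+2), _∙_, ε, _⁻¹) a group of order 4t+2
    (_∙_ : Fin (4 * t + 2) → Fin (4 * t + 2) → Fin (4 * t + 2))
    (ε : Fin (4 * t + 2)) (_⁻¹ : Fin (4 * t + 2) → Fin (4 * t + 2)) →
    IsGroup _≡_ _∙_ ε _⁻¹ →
    -- (i)
    ((ψ : Fin (4 * t + 2) → Fin (4 * t + 2) → Sign) →
      IsCocycle _∙_ ε ψ → QuasiOrthogonal _∙_ ε t ψ →
      IsQuasiHadamard Eψ-≟ (Eψ-elems (4 * t + 2)) (Eψ-mul _∙_ ψ)
        (S.+ , ε) (S.- , ε) t (λ x → isPlus (proj₁ x)))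
    ×
    -- (ii)
    ((_·_ : Fin (8 * t + 4) → Fin (8 * t + 4) → Fin (8 * t + 4))
     (eE : Fin (8 * t + 4)) (_⁻¹ᴱ : Fin (8 * t + 4) → Fin (8 * t + 4)) →
      IsGroup _≡_ _·_ eE _⁻¹ᴱ →
      -- the central subgroup ⟨-1⟩ = {eE, m} of order 2
      (m : Fin (8 * t + 4)) → m ≢ eE → m · m ≡ eE → (∀ x → m · x ≡ x · m) →
      -- identification E/⟨-1⟩ ≅ G via a surjective homomorphism with kernel {eE, m}
      (π : Fin (8 * t + 4) → Fin (4 * t + 2)) →
      (∀ x y → π (x · y) ≡ π x ∙ π y) →
      (∀ g → ∃ λ x → π x ≡ g) →
      (∀ x → π x ≡ ε → x ≡ eE ⊎ x ≡ m) →
      (∀ x → x ≡ eE ⊎ x ≡ m → π x ≡ ε) →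
      (T : Fin (8 * t + 4) → Bool) →
      IsQuasiHadamard Fin._≟_ (allFin (8 * t + 4)) _·_ eE m t T →
      T eE ≡ true →
      -- σ : G → T, the coset representative map
      (σ : Fin (4 * t + 2) → Fin (8 * t + 4)) →
      (∀ g → T (σ g) ≡ true) → (∀ g → π (σ g) ≡ g) →
      QuasiOrthogonal _∙_ ε t (ψ-of _∙_ _·_ eE _⁻¹ᴱ σ))
theorem1 t _ _∙_ ε _⁻¹ isGroup =
    (λ ψ isCocycle quasiOrthogonal →
       QuasiHadamardFromCocycle.quasiHadamard t _∙_ ε _⁻¹ isGroup ψ isCocycle quasiOrthogonal)
  , (λ _·_ eE _⁻¹ᴱ isGroupᴱ m _ _ _ π π-hom _ kernel⊆ ⊆kernel T quasiHadamard eE∈T σ σ∈T πσ →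
       QuasiOrthogonalFromQuasiHadamard.quasiOrthogonal t _∙_ ε _⁻¹ isGroup _·_ eE _⁻¹ᴱ isGroupᴱ
         m π π-hom kernel⊆ ⊆kernel T quasiHadamard eE∈T σ σ∈T πσ)
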